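{- Assume Erdős' girth conjecture: for every integer $k\ge1$ there exist (infinitely many) graphs with $n$ vertices, $\Omega(n^{1+1/k})$ edges and girth $2k+1$. Then for every integer $k\ge2$ there exist graphs $G$ (an infinite family, with uniform implied constant) with unit edge lengths such that for every $(k-1,1)$-contraction $C$ of $G$, the contracted graph $G/C$ has $\Omega(n^{1+1/k})$ edges, where $n$ is the number of vertices of $G$.
   Context: For $C\subseteq E$, $\ell_C$ equals $0$ on $C$ and $1$ elsewhere. An $(\alpha,\beta)$-contraction is a set $C\subseteq E$ with $\mathrm{dist}_{\ell_C}(u,v)\ge\mathrm{dist}_\ell(u,v)/\alpha-\beta$ for all vertices $u,v$. $G/C$ is the simple graph obtained from $G$ by contracting the edges of $C$, deleting loops and merging parallel edges. The girth is the minimum length of a cycle. -}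

module Defs where

open import Data.Nat using (ℕ; zero; suc; _+_; _*_; _∸_; _^_; _≤_; _<_; _<ᵇ_)
open import Data.Bool using (Bool; true; false; if_then_else_; _∧_)
open import Data.Fin as Fin using (Fin; toℕ; inject₁; fromℕ)
open import Data.List using (List; map; allFin)
open import Data.Nat.ListAction using (sum)
open import Data.Product using (Σ; _×_; _,_; proj₁; proj₂)
open import Data.Empty using (⊥)
open import Data.Sum using (_⊎_)
open import Relation.Nullary using (¬_)
open import Relation.Binary.PropositionalEquality using (_≡_; _≢_)
open import Function.Definitions using (Injective)

record Graph (n : ℕ) : Set where
  field
    adj   : Fin n → Fin n → Bool
    sym   : ∀ u v → adj u v ≡ adj v u
    irref : ∀ u → adj u u ≡ false
open Graph public

numEdges : ∀ {n} → Graph n → ℕ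
numEdges {n} G =
  sum (map (λ u → sum (map (λ v → if (toℕ u <ᵇ toℕ v) ∧ adj G u v then 1 else 0)
                           (allFin n)))
           (allFin n))

-- Cycle of length suc m (needs suc m ≥ 3): vertices c 0, …, c m, pairwise distinct,
-- with c i ~ c (i+1) for i < m and the closing edge c m ~ c 0.
HasCycleOfLength : ∀ {n} → Graph n → ℕ → Set
HasCycleOfLength G zero = ⊥
HasCycleOfLength {n} G (suc m) =
  2 ≤ m × Σ (Fin (suc m) → Fin n) λ c → Injective _≡_ _≡_ c ×
    ((∀ (i : Fin m) → adj G (c (inject₁ i)) (c (Fin.suc i)) ≡ true) ×
     adj G (c (fromℕ m)) (c Fin.zero) ≡ true)

Girth : ∀ {n} → Graph n → ℕ → Set
Girth G g = HasCycleOfLength G g × (∀ L → L < g → ¬ HasCycleOfLength G L)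

data Walk {n} (G : Graph n) : Fin n → Fin n → Set where
  nil  : ∀ {u} → Walk G u u
  cons : ∀ {u w v} → adj G u w ≡ true → Walk G w v → Walk G u v

len : ∀ {n} {G : Graph n} {u v} → Walk G u v → ℕ
len nil = 0
len (cons _ p) = suc (len p)

record EdgeSubset {n} (G : Graph n) : Set where
  field
    mem : Fin n → Fin n → Bool
    sym : ∀ u v → mem u v ≡ mem v u
    sub : ∀ u v → mem u v ≡ true → adj G u v ≡ true
open EdgeSubset public

lenC : ∀ {n} {G : Graph n} (C : EdgeSubset G) {u v} → Walk G u v → ℕ
lenC C nil = 0
lenC C (cons {u} {w} _ p) = (if mem C u w then 0 else 1) + lenC C p

-- dist_ℓ(u,v) ≤ d   and   dist_{ℓ_C}(u,v) ≤ d   (distances are minima over walks; ∞ if none).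
DistLe : ∀ {n} (G : Graph n) → Fin n → Fin n → ℕ → Set
DistLe G u v d = Σ (Walk G u v) λ p → len p ≤ d

DistCLe : ∀ {n} {G : Graph n} (C : EdgeSubset G) → Fin n → Fin n → ℕ → Set
DistCLe {G = G} C u v d = Σ (Walk G u v) λ p → lenC C p ≤ d

-- (α,β)-contraction for natural α ≥ 1, β:  dist_C(u,v) ≥ dist(u,v)/α − β  for all u,v,
-- i.e. dist(u,v) ≤ α·(dist_C(u,v) + β), written without ∞ as:
-- whenever dist_C(u,v) ≤ d then dist(u,v) ≤ α·(d + β).
IsContraction : ∀ {n} {G : Graph n} → EdgeSubset G → ℕ → ℕ → Set
IsContraction {n} {G} C α β =
  ∀ (u v : Fin n) (d : ℕ) → DistCLe C u v d → DistLe G u v (α * (d + β))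

-- u and v are identified in G/C: joined by a walk using only edges of C.
SameComp : ∀ {n} {G : Graph n} → EdgeSubset G → Fin n → Fin n → Set
SameComp {G = G} C u v = Σ (Walk G u v) λ p → lenC C p ≡ 0

-- G/C has at least m edges: there are m edges u_i v_i of G, none inside a
-- C-component (so they survive as non-loops), whose images {[u_i],[v_i]} in G/C
-- are pairwise distinct.
AtLeastEdgesQuot : ∀ {n} {G : Graph n} → EdgeSubset G → ℕ → Set
AtLeastEdgesQuot {n} {G} C m =
  Σ (Fin m → Fin n × Fin n) λ e →
    (∀ i → adj G (proj₁ (e i)) (proj₂ (e i)) ≡ true
           × ¬ SameComp C (proj₁ (e i)) (proj₂ (e i))) ×
    (∀ i j → i ≢ j →
       ¬ ((SameComp C (proj₁ (e i)) (proj₁ (e j)) × SameComp C (proj₂ (e i)) (proj₂ (e j)))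
          ⊎ (SameComp C (proj₁ (e i)) (proj₂ (e j)) × SameComp C (proj₂ (e i)) (proj₁ (e j)))))

-- Erdős' girth conjecture (as stated): for every k ≥ 1 there are infinitely many graphs
-- (arbitrarily large n) with n vertices, girth 2k+1 and ≥ c·n^{1+1/k} edges, c = 1/q > 0 uniform.
-- "numEdges ≥ n^{1+1/k}/q" is written  n^(k+1) ≤ (q·numEdges)^k.
GirthConjecture : Set
GirthConjecture =
  ∀ (k : ℕ) → 1 ≤ k →
    Σ ℕ λ q → 1 ≤ q × ∀ (N : ℕ) → Σ ℕ λ n → N ≤ n × Σ (Graph n) λ G →
      Girth G (2 * k + 1) × n ^ (k + 1) ≤ (q * numEdges G) ^ k

module Submission where

-- Let G have no cycle of length ≤ 2k and let C be an (α,β)-contraction of G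
-- with αβ < k (the theorem uses α = k − 1, β = 1).  The engine is that two
-- non-backtracking walks between the same vertices of total length ≤ 2k
-- coincide (NoShortCycles).  From this (SmallContraction, ContractionForest):
--   * every non-backtracking walk in C has fewer than k steps: its first k
--     steps join vertices at ℓ_C-distance 0, hence at G-distance ≤ αβ < k;
--   * C is a forest: each C-edge is charged to its endpoint farther from the
--     least vertex of its component, injectively, so |C| ≤ n;
--   * edges outside C join different C-components, and distinct such edges
--     join distinct pairs of components, so they remain distinct edges of G/C.
-- Hence |E(G/C)| ≥ |E(G)| − n.  The dense graphs given by the girth conjecture
-- with n ≥ (2q)^k vertices have |E(G)| ≥ 2n, so half of their edges survive,
-- which yields the theorem with constant 2q.

open import Defs hiding (sym)

open import Data.Bool using (Bool; true; false; if_then_else_; not; _∧_; T)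
open import Data.Bool.Properties using (T-∧; T-≡; T-not-≡) renaming (_≟_ to _≟ᵇ_)
open import Data.Empty using (⊥; ⊥-elim)
open import Data.Fin using (Fin; toℕ; inject₁; fromℕ; fromℕ<; inject)
import Data.Fin as Fin
open import Data.Fin.Properties
  using (_≟_; any?; injective⇒≤; ¬∀⟶∃¬-smallest; toℕ-injective; toℕ-inject; toℕ-fromℕ<; <-cmp)
open import Data.List
  using (List; []; _∷_; _++_; length; lookup; reverse; _ʳ++_; take; drop; map; filterᵇ; cartesianProduct; allFin)
open import Data.List.Membership.Propositional using (_∈_; _∉_)
open import Data.List.Membership.Propositional.Properties using (∈-++⁺ʳ; ∈-lookup; ∈-∃++; ∈-filter⁻)
open import Data.List.Properties
  using (length-++; length-++-≤ˡ; length-++-sucʳ; ∷-injectiveˡ; ≡-dec; filter-++; length-ʳ++; ʳ++-defn;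
         take++drop≡id; length-take)
import Data.List.Relation.Unary.All as All
open import Data.List.Relation.Unary.All.Properties using (¬Any⇒All¬; ++⁻ˡ)
open import Data.List.Relation.Unary.AllPairs using ([]; _∷_)
open import Data.List.Relation.Unary.Any using (here; there)
open import Data.List.Relation.Unary.Any.Properties using (reverse⁺)
open import Data.List.Relation.Unary.Linked using (Linked; []; [-]; _∷_)
import Data.List.Relation.Unary.Linked as Linked
open import Data.List.Relation.Unary.Unique.Propositional using (Unique)
open import Data.List.Relation.Unary.Unique.Propositional.Properties
  using (Unique[x∷xs]⇒x∉xs; filter⁺; cartesianProduct⁺; allFin⁺)
open import Data.Nat
  using (ℕ; zero; suc; _+_; _*_; _∸_; _^_; _≤_; _<_; z≤n; s≤s; _≤?_; _<ᵇ_; NonZero; >-nonZero)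
import Data.Nat.Properties as ℕ
open import Data.Nat.Properties
  using (≤-refl; ≤-reflexive; ≤-trans; m≤n+m; n≤1+n; +-comm; +-suc; +-mono-≤; +-monoˡ-≤; +-identityʳ;
         ≰⇒>; <⇒≤; <ᵇ⇒<; <⇒≱; m≤n⇒m⊓n≡m; m≤m+n; *-assoc; *-comm; *-identityʳ; ^-monoˡ-<;
         ^-monoˡ-≤; *-monoʳ-<; *-monoʳ-≤; *-monoˡ-≤; +-cancelˡ-≤; module ≤-Reasoning)
open import Data.Nat.ListAction using (sum)
open import Data.Nat.Solver using (module +-*-Solver)
open import Data.Product using (Σ; _×_; _,_; proj₁; proj₂; ∃)
open import Data.Sum using (_⊎_; inj₁; inj₂)
open import Data.Unit using (⊤; tt)
open import Function using (_∘_; case_of_)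
open import Function.Bundles using (Equivalence)
open import Relation.Binary.Definitions using (DecidableEquality; tri<; tri≈; tri>)
open import Relation.Binary.PropositionalEquality
  using (_≡_; _≢_; refl; sym; trans; cong; cong₂; subst; subst₂; module ≡-Reasoning)
open import Relation.Nullary using (¬_; contradiction; yes; no)
open import Relation.Nullary.Decidable using (Dec; T?; ¬?; decidable-stable; map′; _⊎-dec_; _×-dec_)
open import Relation.Unary using (Decidable)

suc-≤-+1 : ∀ {m j} → m ≤ j → suc m ≤ j + 1
suc-≤-+1 {m} {j} h = subst (suc m ≤_) (+-comm 1 j) (s≤s h)

+-≤-double : ∀ {a b k} → a ≤ k → b ≤ k → a + b ≤ 2 * k
+-≤-double {a} {b} {k} a≤k b≤k = subst (a + b ≤_) (cong (k +_) (sym (+-identityʳ k))) (+-mono-≤ a≤k b≤k)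

module Sequences {A : Set} where

  -- A walk is a start vertex x followed by the list l of vertices it visits;
  -- 'end x l' is its last vertex.
  end : A → List A → A
  end x []      = x
  end x (y ∷ l) = end y l

  end-∈ : ∀ x l → end x l ∈ x ∷ l
  end-∈ x []      = here refl
  end-∈ x (y ∷ l) = there (end-∈ y l)

  end-snoc : ∀ x l q → end x (l ++ q ∷ []) ≡ q
  end-snoc x []      q = refl
  end-snoc x (y ∷ l) q = end-snoc y l q

  NonBacktracking : List A → Set
  NonBacktracking (a ∷ b ∷ c ∷ l) = a ≢ c × NonBacktracking (b ∷ c ∷ l)
  NonBacktracking _               = ⊤

  NBWalk : (A → A → Set) → List A → Set
  NBWalk R l = Linked R l × NonBacktracking l

  nb-tail : ∀ x l → NonBacktracking (x ∷ l) → NonBacktracking l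
  nb-tail x []          _       = tt
  nb-tail x (y ∷ [])    _       = tt
  nb-tail x (y ∷ z ∷ l) (_ , h) = h

  nbw-tail : ∀ {R : A → A → Set} x l → NBWalk R (x ∷ l) → NBWalk R l
  nbw-tail x l (c , h) = Linked.tail c , nb-tail x l h

  linked-prefix : ∀ {R : A → A → Set} x p s → Linked R (x ∷ p ++ s) → Linked R (x ∷ p)
  linked-prefix x []      s _       = [-]
  linked-prefix x (y ∷ p) s (r ∷ c) = r ∷ linked-prefix y p s c

  nb-prefix : ∀ x p s → NonBacktracking (x ∷ p ++ s) → NonBacktracking (x ∷ p)
  nb-prefix x []          s _       = tt
  nb-prefix x (y ∷ [])    s _       = tt
  nb-prefix x (y ∷ z ∷ p) s (h , r) = h , nb-prefix y (z ∷ p) s r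

  nbw-prefix : ∀ {R : A → A → Set} x p s → NBWalk R (x ∷ p ++ s) → NBWalk R (x ∷ p)
  nbw-prefix x p s (c , h) = linked-prefix x p s c , nb-prefix x p s h

  linked-join : ∀ {R : A → A → Set} x p b s → Linked R (x ∷ p ++ b ∷ s) → R (end x p) b
  linked-join x []      b s (r ∷ _) = r
  linked-join x (y ∷ p) b s (_ ∷ c) = linked-join y p b s c

  linked-snoc : ∀ {R : A → A → Set} x t q → Linked R (x ∷ t) → R (end x t) q → Linked R (x ∷ t ++ q ∷ [])
  linked-snoc x []      q _       r = r ∷ [-]
  linked-snoc x (y ∷ t) q (r′ ∷ c) r = r′ ∷ linked-snoc y t q c r

  Diverge : List A → List A → Set
  Diverge (y ∷ _) (z ∷ _) = y ≢ z
  Diverge _       _       = ⊤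

  linked-glue : ∀ {R : A → A → Set} → (∀ {a b} → R a b → R b a) →
                ∀ x xs ys → Linked R (x ∷ xs) → Linked R (x ∷ ys) → Linked R (xs ʳ++ x ∷ ys)
  linked-glue R-sym x []       ys _       cy = cy
  linked-glue R-sym x (y ∷ xs) ys (r ∷ cx) cy = linked-glue R-sym y xs (x ∷ ys) cx (R-sym r ∷ cy)

  nb-glue : ∀ x xs ys → NonBacktracking (x ∷ xs) → NonBacktracking (x ∷ ys) → Diverge xs ys →
            NonBacktracking (xs ʳ++ x ∷ ys)
  nb-glue x []       ys _  hy _ = hy
  nb-glue x (y ∷ xs) ys hx hy d = nb-glue y xs (x ∷ ys) (nb-tail x (y ∷ xs) hx) (turn ys hy d) (back xs hx)
    where
    turn : ∀ ys → NonBacktracking (x ∷ ys) → Diverge (y ∷ xs) ys → NonBacktracking (y ∷ x ∷ ys)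
    turn []       _  _ = tt
    turn (z ∷ ys) hy d = d , hy
    back : ∀ xs → NonBacktracking (x ∷ y ∷ xs) → Diverge xs (x ∷ ys)
    back []       _       = tt
    back (z ∷ xs) (h , _) = λ e → h (sym e)

  nbw-glue : ∀ {R : A → A → Set} → (∀ {a b} → R a b → R b a) → ∀ x xs ys →
             NBWalk R (x ∷ xs) → NBWalk R (x ∷ ys) → Diverge xs ys → NBWalk R (xs ʳ++ x ∷ ys)
  nbw-glue R-sym x xs ys (cx , hx) (cy , hy) d = linked-glue R-sym x xs ys cx cy , nb-glue x xs ys hx hy d

  unique-∷ : ∀ {x : A} {xs} → x ∉ xs → Unique xs → Unique (x ∷ xs)
  unique-∷ {xs = xs} x∉xs u = ¬Any⇒All¬ xs x∉xs ∷ u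

  unique-prefix : ∀ (xs : List A) {ys} → Unique (xs ++ ys) → Unique xs
  unique-prefix []       _         = []
  unique-prefix (x ∷ xs) (px ∷ u) = ++⁻ˡ xs px ∷ unique-prefix xs u

  unique-disjoint : ∀ (xs : List A) {ys z} → Unique (xs ++ ys) → z ∈ xs → z ∈ ys → ⊥
  unique-disjoint (x ∷ xs) (px ∷ u) (here refl) z∈ys = All.lookup px (∈-++⁺ʳ xs z∈ys) refl
  unique-disjoint (x ∷ xs) (px ∷ u) (there z∈xs) z∈ys = unique-disjoint xs u z∈xs z∈ys

  lookup-injective : ∀ {xs : List A} → Unique xs → ∀ i j → lookup xs i ≡ lookup xs j → i ≡ j
  lookup-injective (px ∷ u) Fin.zero    Fin.zero    e = refl
  lookup-injective (px ∷ u) Fin.zero    (Fin.suc j) e = contradiction e (All.lookup px (∈-lookup j))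
  lookup-injective (px ∷ u) (Fin.suc i) Fin.zero    e = contradiction (sym e) (All.lookup px (∈-lookup i))
  lookup-injective (px ∷ u) (Fin.suc i) (Fin.suc j) e = cong Fin.suc (lookup-injective u i j e)

module Reduction {A : Set} (_≟_ : DecidableEquality A) where
  open Sequences {A}

  step : A → A → List A → List A
  step a b []      = b ∷ []
  step a b (c ∷ r) with a ≟ c
  ... | yes _ = r
  ... | no  _ = b ∷ c ∷ r

  reduce : A → List A → List A
  reduce a []      = []
  reduce a (b ∷ l) = step a b (reduce b l)

  reduce-end : ∀ a l → end a (reduce a l) ≡ end a l
  reduce-end a []      = refl
  reduce-end a (b ∷ l) = trans (step-end (reduce b l)) (reduce-end b l)
    where
    step-end : ∀ r → end a (step a b r) ≡ end b r
    step-end []      = refl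
    step-end (c ∷ r) with a ≟ c
    ... | yes refl = refl
    ... | no  _    = refl

  reduce-length : ∀ a l → length (reduce a l) ≤ length l
  reduce-length a []      = z≤n
  reduce-length a (b ∷ l) = ≤-trans (step-length (reduce b l)) (s≤s (reduce-length b l))
    where
    step-length : ∀ r → length (step a b r) ≤ suc (length r)
    step-length []      = ≤-refl
    step-length (c ∷ r) with a ≟ c
    ... | yes _ = m≤n+m (length r) 2
    ... | no  _ = ≤-refl

  reduce-nbwalk : ∀ {R : A → A → Set} a l → Linked R (a ∷ l) → NBWalk R (a ∷ reduce a l)
  reduce-nbwalk a []      _       = [-] , tt
  reduce-nbwalk a (b ∷ l) (r ∷ c) = step-nbwalk (reduce b l) (reduce-nbwalk b l c)
    where
    step-nbwalk : ∀ s → NBWalk _ (b ∷ s) → NBWalk _ (a ∷ step a b s)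
    step-nbwalk []      _              = r ∷ [-] , tt
    step-nbwalk (c ∷ s) (cs , hs) with a ≟ c
    ... | yes refl = Linked.tail cs , nb-tail b (a ∷ s) hs
    ... | no  a≢c  = r ∷ cs , a≢c , hs

module Counting {A : Set} where
  open Sequences {A}

  ∈-filterᵇ⁻ : ∀ {p : A → Bool} {xs x} → x ∈ filterᵇ p xs → T (p x)
  ∈-filterᵇ⁻ {p} {xs} h = proj₂ (∈-filter⁻ (T? ∘ p) {xs = xs} h)

  length-split : ∀ (p : A → Bool) xs → length (filterᵇ p xs) + length (filterᵇ (not ∘ p) xs) ≡ length xs
  length-split p []       = refl
  length-split p (x ∷ xs) with p x
  ... | true  = cong suc (length-split p xs)
  ... | false = trans (+-suc _ _) (cong suc (length-split p xs))

  injection-bound : ∀ {n} {xs : List A} → Unique xs → (g : A → Fin n) →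
                    (∀ {a b} → a ∈ xs → b ∈ xs → g a ≡ g b → a ≡ b) → length xs ≤ n
  injection-bound u g g-inj = injective⇒≤ λ {i} {j} e → lookup-injective u i j (g-inj (∈-lookup i) (∈-lookup j) e)

double-count : ∀ {A B : Set} (p : A × B → Bool) xs ys →
               sum (map (λ x → sum (map (λ y → if p (x , y) then 1 else 0) ys)) xs) ≡
               length (filterᵇ p (cartesianProduct xs ys))
double-count p []       ys = refl
double-count p (x ∷ xs) ys = begin
  sum (map (λ y → if p (x , y) then 1 else 0) ys) + _  ≡⟨ cong₂ _+_ (row ys) (double-count p xs ys) ⟩
  length (filterᵇ p (map (x ,_) ys)) + length (filterᵇ p (cartesianProduct xs ys))
    ≡⟨ sym (length-++ (filterᵇ p (map (x ,_) ys))) ⟩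
  length (filterᵇ p (map (x ,_) ys) ++ filterᵇ p (cartesianProduct xs ys))
    ≡⟨ cong length (sym (filter-++ (T? ∘ p) (map (x ,_) ys) (cartesianProduct xs ys))) ⟩
  length (filterᵇ p (map (x ,_) ys ++ cartesianProduct xs ys)) ∎
  where
  open ≡-Reasoning
  row : ∀ ys → sum (map (λ y → if p (x , y) then 1 else 0) ys) ≡ length (filterᵇ p (map (x ,_) ys))
  row []       = refl
  row (y ∷ ys) with p (x , y)
  ... | true  = cong suc (row ys)
  ... | false = row ys

module GraphWalks {n : ℕ} (G : Graph n) where
  open Sequences {Fin n}
  open Counting {Fin n × Fin n}

  Adj : Fin n → Fin n → Set
  Adj a b = adj G a b ≡ true

  adj-sym : ∀ {a b} → Adj a b → Adj b a
  adj-sym {a} {b} h = trans (Graph.sym G b a) h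

  vertices : ∀ {u v} → Walk G u v → List (Fin n)
  vertices nil                  = []
  vertices (cons {w = w} _ p) = w ∷ vertices p

  vertices-linked : ∀ {u v} (p : Walk G u v) → Linked Adj (u ∷ vertices p)
  vertices-linked nil        = [-]
  vertices-linked (cons h p) = h ∷ vertices-linked p

  vertices-end : ∀ {u v} (p : Walk G u v) → end u (vertices p) ≡ v
  vertices-end nil        = refl
  vertices-end (cons _ p) = vertices-end p

  vertices-length : ∀ {u v} (p : Walk G u v) → length (vertices p) ≡ len p
  vertices-length nil        = refl
  vertices-length (cons _ p) = cong suc (vertices-length p)

  cycle-of-path : ∀ a l → 2 ≤ length l → Linked Adj (a ∷ l) → Unique (a ∷ l) → Adj (end a l) a →
                  HasCycleOfLength G (suc (length l))
  cycle-of-path a l 2≤l c u closing =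
    2≤l , lookup (a ∷ l) , (λ {i} {j} → lookup-injective u i j) , consecutive a l c ,
    subst (λ z → Adj z a) (sym (lookup-last a l)) closing
    where
    consecutive : ∀ a l → Linked Adj (a ∷ l) →
                  ∀ i → Adj (lookup (a ∷ l) (inject₁ i)) (lookup (a ∷ l) (Fin.suc i))
    consecutive a (b ∷ l) (r ∷ c) Fin.zero    = r
    consecutive a (b ∷ l) (r ∷ c) (Fin.suc i) = consecutive b l c i
    lookup-last : ∀ a l → lookup (a ∷ l) (fromℕ (length l)) ≡ end a l
    lookup-last a []      = refl
    lookup-last a (b ∷ l) = lookup-last b l

  isEdge : Fin n × Fin n → Bool
  isEdge (u , v) = (toℕ u <ᵇ toℕ v) ∧ adj G u v

  edgeList : List (Fin n × Fin n)
  edgeList = filterᵇ isEdge (cartesianProduct (allFin n) (allFin n))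

  numEdges≡ : numEdges G ≡ length edgeList
  numEdges≡ = double-count isEdge (allFin n) (allFin n)

  edgeList-unique : Unique edgeList
  edgeList-unique = filter⁺ (T? ∘ isEdge) (cartesianProduct⁺ (allFin⁺ n) (allFin⁺ n))

  ∈-edgeList : ∀ {u v} → (u , v) ∈ edgeList → toℕ u < toℕ v × Adj u v
  ∈-edgeList {u} {v} h with Equivalence.to T-∧ (∈-filterᵇ⁻ {p = isEdge} {xs = cartesianProduct (allFin n) (allFin n)} h)
  ... | u<v , uv = <ᵇ⇒< _ _ u<v , Equivalence.to T-≡ uv

module ContractedWalks {n : ℕ} {G : Graph n} (C : EdgeSubset G) where
  open Sequences {Fin n}
  open GraphWalks G

  CAdj : Fin n → Fin n → Set
  CAdj a b = mem C a b ≡ true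

  cadj-sym : ∀ {a b} → CAdj a b → CAdj b a
  cadj-sym {a} {b} h = trans (EdgeSubset.sym C b a) h

  cadj⇒adj : ∀ {a b} → CAdj a b → Adj a b
  cadj⇒adj {a} {b} = sub C a b

  vertices-linkedC : ∀ {u v} (p : Walk G u v) → lenC C p ≡ 0 → Linked CAdj (u ∷ vertices p)
  vertices-linkedC nil                  _ = [-]
  vertices-linkedC (cons {u} {w} _ p) e with mem C u w in uw
  vertices-linkedC (cons {u} {w} _ p) e | true = uw ∷ vertices-linkedC p e

  sameComp-∷ : ∀ {x w z} → CAdj x w → SameComp C w z → SameComp C x z
  sameComp-∷ {x} {w} h (p , e) = cons (sub C x w h) p , trans (cong (λ b → (if b then 0 else 1) + lenC C p) h) e

  sameComp-linked : ∀ u l → Linked CAdj (u ∷ l) → SameComp C u (end u l)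
  sameComp-linked u []      _       = nil , refl
  sameComp-linked u (w ∷ l) (h ∷ c) = sameComp-∷ h (sameComp-linked w l c)

  Survives : Fin n × Fin n → Set
  Survives (u , v) = Adj u v × ¬ SameComp C u v

  Identified : Fin n × Fin n → Fin n × Fin n → Set
  Identified (u , v) (u′ , v′) = (SameComp C u u′ × SameComp C v v′) ⊎ (SameComp C u v′ × SameComp C v u′)

  nbwalk-cadj⇒adj : ∀ {l} → NBWalk CAdj l → NBWalk Adj l
  nbwalk-cadj⇒adj (c , h) = Linked.map cadj⇒adj c , h

  -- An edge outside C cannot undo the adjacent step of a C-walk, so it
  -- extends a non-backtracking C-walk, at either end, without backtracking.
  nb-snoc-outside : ∀ x t q → NBWalk CAdj (x ∷ t) → ¬ CAdj (end x t) q → NonBacktracking (x ∷ t ++ q ∷ [])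
  nb-snoc-outside x []          q _                 _   = tt
  nb-snoc-outside x (b ∷ [])    q (xb ∷ _ , _)      out = (λ { refl → out (cadj-sym xb) }) , tt
  nb-snoc-outside x (b ∷ c ∷ t) q (_ ∷ cs , x≢c , h) out = x≢c , nb-snoc-outside b (c ∷ t) q (cs , h) out

  nb-cons-outside : ∀ x y t → ¬ CAdj x y → NBWalk CAdj (y ∷ t) → NonBacktracking (x ∷ y ∷ t)
  nb-cons-outside x y []      _   _             = tt
  nb-cons-outside x y (c ∷ t) out (yc ∷ _ , h) = (λ { refl → out (cadj-sym yc) }) , h

module NoShortCycles {n : ℕ} (G : Graph n) (k : ℕ)
         (no-short-cycle : ∀ L → L < 2 * k + 1 → ¬ HasCycleOfLength G L) where
  open Sequences {Fin n}
  open GraphWalks G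

  -- A non-backtracking walk that returns to its start after at most 2k steps
  -- (and may continue afterwards) closes a cycle of length ≤ 2k; impossible.
  no-early-return : ∀ a pre post → NBWalk Adj (a ∷ pre ++ a ∷ post) →
                    length (a ∷ pre ++ a ∷ post) ≤ 2 * k + 1 → Unique (pre ++ a ∷ post) → ⊥
  no-early-return a [] post (loop ∷ _ , _) _ _ = contradiction (trans (sym loop) (irref G a)) λ ()
  no-early-return a (b ∷ []) post (_ , a≢a , _) _ _ = a≢a refl
  no-early-return a pre@(_ ∷ _ ∷ _) post w len u =
    no-short-cycle (suc (length pre)) short
      (cycle-of-path a pre (s≤s (s≤s z≤n)) (linked-prefix a pre (a ∷ post) (proj₁ w))
        (unique-∷ (λ a∈pre → unique-disjoint pre u a∈pre (here refl)) (unique-prefix pre u))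
        (linked-join a pre a post (proj₁ w)))
    where
    short : suc (length pre) < 2 * k + 1
    short = ≤-trans (s≤s (s≤s (length-++-≤ˡ pre)))
              (≤-trans (≤-reflexive (cong suc (sym (length-++-sucʳ pre a post)))) len)

  nbwalk-unique : ∀ l → NBWalk Adj l → length l ≤ 2 * k + 1 → Unique l
  nbwalk-unique []      _ _   = []
  nbwalk-unique (a ∷ l) w len = unique-∷ a∉l rest
    where
    rest : Unique l
    rest = nbwalk-unique l (nbw-tail a l w) (≤-trans (n≤1+n _) len)
    a∉l : a ∉ l
    a∉l a∈l with ∈-∃++ a∈l
    ... | pre , post , refl = no-early-return a pre post w len rest

  -- Unique short walks: two non-backtracking walks between the same vertices
  -- of total length ≤ 2k coincide; otherwise, where they first diverge, the
  -- first one reversed followed by the second would be a non-backtracking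
  -- walk of length ≤ 2k revisiting its start.
  nbwalks-coincide : ∀ v a b → NBWalk Adj (v ∷ a) → NBWalk Adj (v ∷ b) → end v a ≡ end v b →
                     length a + length b ≤ 2 * k → a ≡ b
  nbwalks-coincide v []      []      _  _  _ _   = refl
  nbwalks-coincide v []      (y ∷ b) _  wb e len =
    contradiction (subst (_∈ y ∷ b) (sym e) (end-∈ y b))
      (Unique[x∷xs]⇒x∉xs (nbwalk-unique (v ∷ y ∷ b) wb (suc-≤-+1 len)))
  nbwalks-coincide v (x ∷ a) []      wa wb e len =
    sym (nbwalks-coincide v [] (x ∷ a) wb wa (sym e) (≤-trans (≤-reflexive (+-comm 0 (suc (length a)))) len))
  nbwalks-coincide v (x ∷ a) (y ∷ b) wa wb e len with x ≟ y
  ... | yes refl = cong (x ∷_) (nbwalks-coincide x a b (nbw-tail v (x ∷ a) wa) (nbw-tail v (x ∷ b) wb) e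
                     (≤-trans (+-mono-≤ (n≤1+n _) (n≤1+n _)) len))
  ... | no x≢y   = ⊥-elim (unique-disjoint (reverse (x ∷ a)) glued-unique (reverse⁺ (end-∈ x a))
                     (there (subst (_∈ y ∷ b) (sym e) (end-∈ y b))))
    where
    glued-length : length ((x ∷ a) ʳ++ v ∷ y ∷ b) ≤ 2 * k + 1
    glued-length = ≤-trans (≤-reflexive (trans (length-ʳ++ (x ∷ a)) (+-suc (suc (length a)) (suc (length b)))))
                     (suc-≤-+1 len)
    glued-unique : Unique (reverse (x ∷ a) ++ v ∷ y ∷ b)
    glued-unique = subst Unique (ʳ++-defn (x ∷ a))
      (nbwalk-unique _ (nbw-glue adj-sym v (x ∷ a) (y ∷ b) wa wb x≢y) glued-length)

module FinOrder {n : ℕ} where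

  Least : (Fin n → Set) → Fin n → Set
  Least P i = P i × (∀ j → j Fin.< i → ¬ P j)

  least : ∀ {P : Fin n → Set} → Decidable P → ∃ P → ∃ (Least P)
  least {P} P? (x , px) with ¬∀⟶∃¬-smallest n (¬_ ∘ P) (¬? ∘ P?) (λ all¬P → all¬P x px)
  ... | i , ¬¬Pi , below = i , decidable-stable (P? i) ¬¬Pi , λ j j<i → subst (¬_ ∘ P) (as-inject j<i) (below _)
    where
    as-inject : ∀ {j} (j<i : j Fin.< i) → inject (fromℕ< j<i) ≡ j
    as-inject j<i = toℕ-injective (trans (toℕ-inject (fromℕ< j<i)) (toℕ-fromℕ< j<i))

  least-unique : ∀ {P Q : Fin n → Set} → (∀ z → P z → Q z) → (∀ z → Q z → P z) →
                 ∀ {i j} → Least P i → Least Q j → i ≡ j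
  least-unique P⇒Q Q⇒P {i} {j} (Pi , minP) (Qj , minQ) with <-cmp i j
  ... | tri< i<j _ _ = ⊥-elim (minQ i i<j (P⇒Q i Pi))
  ... | tri≈ _ i≡j _ = i≡j
  ... | tri> _ _ j<i = ⊥-elim (minP j j<i (Q⇒P j Qj))

  SamePair : Fin n → Fin n → Fin n → Fin n → Set
  SamePair x y a b = (x ≡ a × y ≡ b) ⊎ (x ≡ b × y ≡ a)

  increasing-pair-unique : ∀ {x y x′ y′ a b} → toℕ x < toℕ y → toℕ x′ < toℕ y′ →
                           SamePair x y a b → SamePair x′ y′ a b → (x , y) ≡ (x′ , y′)
  increasing-pair-unique _ _ (inj₁ (refl , refl)) (inj₁ (refl , refl)) = refl
  increasing-pair-unique _ _ (inj₂ (refl , refl)) (inj₂ (refl , refl)) = refl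
  increasing-pair-unique x<y x′<y′ (inj₁ (refl , refl)) (inj₂ (refl , refl)) = ⊥-elim (ℕ.<-asym x<y x′<y′)
  increasing-pair-unique x<y x′<y′ (inj₂ (refl , refl)) (inj₁ (refl , refl)) = ⊥-elim (ℕ.<-asym x<y x′<y′)

module SmallContraction {n : ℕ} (G : Graph n) (k : ℕ)
         (no-short-cycle : ∀ L → L < 2 * k + 1 → ¬ HasCycleOfLength G L)
         (C : EdgeSubset G) {α β : ℕ} (αβ<k : α * β < k) (contraction : IsContraction C α β) where
  open Sequences {Fin n}
  open Reduction (_≟_ {n})
  open GraphWalks G
  open ContractedWalks C
  open NoShortCycles G k no-short-cycle

  -- Its first k steps
  -- join two vertices at ℓ_C-distance 0, hence at distance ≤ αβ < k in G; the
  -- reduced G-walk realising this would have to coincide with those k steps.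
  cwalk-short : ∀ x t → NBWalk CAdj (x ∷ t) → length t < k
  cwalk-short x t w with k ≤? length t
  ... | no k≰t  = ≰⇒> k≰t
  ... | yes k≤t = contradiction k≤αβ (<⇒≱ αβ<k)
    where
    p : List (Fin n)
    p = take k t
    wp : NBWalk CAdj (x ∷ p)
    wp = nbw-prefix x p (drop k t) (subst (λ l → NBWalk CAdj (x ∷ l)) (sym (take++drop≡id k t)) w)
    |p|≡k : length p ≡ k
    |p|≡k = trans (length-take k t) (m≤n⇒m⊓n≡m k≤t)
    in-G : DistLe G x (end x p) (α * β)
    in-G = let (c , e) = sameComp-linked x p (proj₁ wp) in contraction x (end x p) 0 (c , ≤-reflexive e)
    g : List (Fin n)
    g = vertices (proj₁ in-G)
    |rg|≤αβ : length (reduce x g) ≤ α * β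
    |rg|≤αβ = ≤-trans (reduce-length x g)
                (≤-trans (≤-reflexive (vertices-length (proj₁ in-G))) (proj₂ in-G))
    p≡rg : p ≡ reduce x g
    p≡rg = nbwalks-coincide x p (reduce x g) (nbwalk-cadj⇒adj wp) (reduce-nbwalk x g (vertices-linked (proj₁ in-G)))
             (sym (trans (reduce-end x g) (vertices-end (proj₁ in-G))))
             (+-≤-double (≤-reflexive |p|≡k) (≤-trans |rg|≤αβ (<⇒≤ αβ<k)))
    k≤αβ : k ≤ α * β
    k≤αβ = subst (_≤ α * β) (trans (cong length (sym p≡rg)) |p|≡k) |rg|≤αβ

  record CPath (x z : Fin n) : Set where
    field
      steps   : List (Fin n)
      walk    : NBWalk CAdj (x ∷ steps)
      reaches : end x steps ≡ z
      short   : length steps < k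

  sameComp⇒cpath : ∀ {x z} → SameComp C x z → CPath x z
  sameComp⇒cpath {x} (p , e) = record
    { steps   = reduce x (vertices p)
    ; walk    = w
    ; reaches = trans (reduce-end x (vertices p)) (vertices-end p)
    ; short   = cwalk-short x _ w }
    where
    w : NBWalk CAdj (x ∷ reduce x (vertices p))
    w = reduce-nbwalk x (vertices p) (vertices-linkedC p e)

  -- An edge outside C joins two different C-components: otherwise the short
  -- C-path between its ends would coincide with the edge itself.
  outside-edge-separates : ∀ {x y} → Adj x y → ¬ CAdj x y → ¬ SameComp C x y
  outside-edge-separates {x} {y} xy out s = no-short-cpath (sameComp⇒cpath s)
    where
    no-short-cpath : CPath x y → ⊥
    no-short-cpath record { steps = t ; walk = w ; reaches = r ; short = t<k }
      with nbwalks-coincide x t (y ∷ []) (nbwalk-cadj⇒adj w) (xy ∷ [-] , tt) r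
             (+-≤-double (<⇒≤ t<k) (≤-trans (s≤s z≤n) t<k))
    ... | refl = out (Linked.head (proj₁ w))

  -- Two edges outside C joining the same two C-components, in the same
  -- orientation, are the same edge: the routes x₁ ⇝ x₂ → y₂ and x₁ → y₁ ⇝ y₂
  -- are non-backtracking walks of total length ≤ 2k, hence they coincide.
  outside-edges-parallel : ∀ {x₁ y₁ x₂ y₂} → Adj x₁ y₁ → ¬ CAdj x₁ y₁ → Adj x₂ y₂ → ¬ CAdj x₂ y₂ →
                           SameComp C x₁ x₂ → SameComp C y₁ y₂ → x₁ ≡ x₂ × y₁ ≡ y₂
  outside-edges-parallel {x₁} {y₁} {x₂} {y₂} e₁ out₁ e₂ out₂ s₁ s₂ =
    compare (sameComp⇒cpath s₁) (sameComp⇒cpath s₂)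
    where
    first-step : ∀ ta tb → NBWalk CAdj (x₁ ∷ ta) → end x₁ ta ≡ x₂ → ta ++ y₂ ∷ [] ≡ y₁ ∷ tb →
                 x₁ ≡ x₂ × y₁ ≡ y₂
    first-step []      tb _            ra e = ra , sym (∷-injectiveˡ e)
    first-step (c ∷ _) tb (xc ∷ _ , _) _  e = ⊥-elim (out₁ (subst (CAdj x₁) (∷-injectiveˡ e) xc))

    compare : CPath x₁ x₂ → CPath y₁ y₂ → x₁ ≡ x₂ × y₁ ≡ y₂
    compare record { steps = ta ; walk = wa ; reaches = ra ; short = ta<k }
            record { steps = tb ; walk = wb ; reaches = rb ; short = tb<k } =
      first-step ta tb wa ra (nbwalks-coincide x₁ (ta ++ y₂ ∷ []) (y₁ ∷ tb) route₁ route₂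
                                (trans (end-snoc x₁ ta y₂) (sym rb)) total)
      where
      route₁ : NBWalk Adj (x₁ ∷ ta ++ y₂ ∷ [])
      route₁ = linked-snoc x₁ ta y₂ (Linked.map cadj⇒adj (proj₁ wa)) (subst (λ z → Adj z y₂) (sym ra) e₂)
             , nb-snoc-outside x₁ ta y₂ wa (subst (λ z → ¬ CAdj z y₂) (sym ra) out₂)
      route₂ : NBWalk Adj (x₁ ∷ y₁ ∷ tb)
      route₂ = e₁ ∷ Linked.map cadj⇒adj (proj₁ wb) , nb-cons-outside x₁ y₁ tb out₁ wb
      total : length (ta ++ y₂ ∷ []) + length (y₁ ∷ tb) ≤ 2 * k
      total = +-≤-double (subst (_≤ k) (sym (trans (length-++ ta) (+-comm (length ta) 1))) ta<k) tb<k

module ContractionForest {n : ℕ} (G : Graph n) (k : ℕ)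
         (no-short-cycle : ∀ L → L < 2 * k + 1 → ¬ HasCycleOfLength G L)
         (C : EdgeSubset G) {α β : ℕ} (αβ<k : α * β < k) (contraction : IsContraction C α β) where
  open Sequences {Fin n}
  open GraphWalks G
  open ContractedWalks C
  open NoShortCycles G k no-short-cycle
  open FinOrder {n}
  open Counting {Fin n × Fin n}
  open SmallContraction G k no-short-cycle C {α} {β} αβ<k contraction

  -- C-components are decidable because they have radius < k: it suffices to
  -- search C-walks of at most k steps.
  ReachWithin : ℕ → Fin n → Fin n → Set
  ReachWithin zero    x z = x ≡ z
  ReachWithin (suc d) x z = x ≡ z ⊎ ∃ λ w → CAdj x w × ReachWithin d w z

  reachWithin? : ∀ d x z → Dec (ReachWithin d x z)
  reachWithin? zero    x z = x ≟ z
  reachWithin? (suc d) x z = x ≟ z ⊎-dec any? (λ w → (mem C x w ≟ᵇ true) ×-dec reachWithin? d w z)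

  reachWithin⇒sameComp : ∀ d {x z} → ReachWithin d x z → SameComp C x z
  reachWithin⇒sameComp zero    refl                = nil , refl
  reachWithin⇒sameComp (suc d) (inj₁ refl)         = nil , refl
  reachWithin⇒sameComp (suc d) (inj₂ (w , xw , r)) = sameComp-∷ xw (reachWithin⇒sameComp d r)

  linked⇒reachWithin : ∀ d x t → Linked CAdj (x ∷ t) → length t ≤ d → ReachWithin d x (end x t)
  linked⇒reachWithin zero    x []      _        _       = refl
  linked⇒reachWithin (suc d) x []      _        _       = inj₁ refl
  linked⇒reachWithin (suc d) x (w ∷ t) (xw ∷ c) (s≤s l) = inj₂ (w , xw , linked⇒reachWithin d w t c l)

  sameComp? : ∀ x z → Dec (SameComp C x z)
  sameComp? x z = map′ (reachWithin⇒sameComp k) within-k (reachWithin? k x z)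
    where
    within-k : SameComp C x z → ReachWithin k x z
    within-k s = subst (ReachWithin k x) reaches (linked⇒reachWithin k x steps (proj₁ walk) (<⇒≤ short))
      where open CPath (sameComp⇒cpath s)

  opaque
    rooted : ∀ x → ∃ (Least (SameComp C x))
    rooted x = least (sameComp? x) (x , nil , refl)

  root : Fin n → Fin n
  root x = proj₁ (rooted x)

  root-cadj : ∀ {x y} → CAdj x y → root x ≡ root y
  root-cadj xy = least-unique (λ _ → sameComp-∷ (cadj-sym xy)) (λ _ → sameComp-∷ xy)
                   (proj₂ (rooted _)) (proj₂ (rooted _))

  -- C-adjacent vertices x, y with short C-paths to a common vertex: one path
  -- extends the other by the edge xy (short non-backtracking walks are unique).
  adjacent-cpaths : ∀ {x y r₁ r₂} → CAdj x y → r₁ ≡ r₂ → (px : CPath x r₁) (py : CPath y r₂) →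
                    CPath.steps py ≡ x ∷ CPath.steps px ⊎ CPath.steps px ≡ y ∷ CPath.steps py
  adjacent-cpaths {x} {y} {r₁} xy r₁≡r₂ record { steps = tx ; walk = wx ; reaches = rx ; short = sx }
                                   record { steps = ty ; walk = wy ; reaches = ry ; short = sy } =
    compare tx wx rx sx
    where
    via-x : ∀ tx → NBWalk CAdj (x ∷ tx) → end x tx ≡ r₁ → length tx < k → NonBacktracking (y ∷ x ∷ tx) →
            ty ≡ x ∷ tx
    via-x tx (cx , _) rx sx nb =
      sym (nbwalks-coincide y (x ∷ tx) ty (adj-sym (cadj⇒adj xy) ∷ Linked.map cadj⇒adj cx , nb)
             (nbwalk-cadj⇒adj wy) (trans rx (trans r₁≡r₂ (sym ry))) (+-≤-double sx (<⇒≤ sy)))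
    compare : ∀ tx → NBWalk CAdj (x ∷ tx) → end x tx ≡ r₁ → length tx < k → ty ≡ x ∷ tx ⊎ tx ≡ y ∷ ty
    compare []      wx rx sx = inj₁ (via-x [] wx rx sx tt)
    compare (w ∷ t) wx rx sx with w ≟ y
    ... | yes refl = inj₂ (cong (w ∷_) (nbwalks-coincide w t ty (nbwalk-cadj⇒adj (nbw-tail x (w ∷ t) wx))
                       (nbwalk-cadj⇒adj wy) (trans rx (trans r₁≡r₂ (sym ry)))
                       (+-≤-double (≤-trans (n≤1+n _) (<⇒≤ sx)) (<⇒≤ sy))))
    ... | no w≢y   = inj₁ (via-x (w ∷ t) wx rx sx ((λ y≡w → w≢y (sym y≡w)) , proj₂ wx))

  pathToRoot : ∀ x → CPath x (root x)
  pathToRoot x = sameComp⇒cpath (proj₁ (proj₂ (rooted x)))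

  toRoot : Fin n → List (Fin n)
  toRoot x = CPath.steps (pathToRoot x)

  Parent : Fin n → Fin n → Set
  Parent c o = toRoot c ≡ o ∷ toRoot o

  cedge-parent : ∀ {x y} → CAdj x y → Parent y x ⊎ Parent x y
  cedge-parent {x} {y} xy = adjacent-cpaths xy (root-cadj xy) (pathToRoot x) (pathToRoot y)

  -- The endpoint of a C-edge farther from the root.
  child : Fin n → Fin n → Fin n
  child x y with ≡-dec _≟_ (toRoot y) (x ∷ toRoot x)
  ... | yes _ = y
  ... | no  _ = x

  child-spec : ∀ {x y} → CAdj x y → ∃ λ o → Parent (child x y) o × SamePair x y o (child x y)
  child-spec {x} {y} xy with ≡-dec _≟_ (toRoot y) (x ∷ toRoot x) | cedge-parent xy
  ... | yes y→x | _        = x , y→x , inj₁ (refl , refl)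
  ... | no ¬y→x | inj₁ y→x = ⊥-elim (¬y→x y→x)
  ... | no _    | inj₂ x→y = y , x→y , inj₂ (refl , refl)

  child-injective : ∀ {x y x′ y′} → toℕ x < toℕ y → CAdj x y → toℕ x′ < toℕ y′ → CAdj x′ y′ →
                    child x y ≡ child x′ y′ → (x , y) ≡ (x′ , y′)
  child-injective {x} {y} {x′} {y′} x<y xy x′<y′ x′y′ same
    with child-spec xy | child-spec x′y′
  ... | o , c→o , pair | o′ , c′→o′ , pair′ =
    increasing-pair-unique x<y x′<y′ pair (subst₂ (SamePair x′ y′) (sym o≡o′) (sym same) pair′)
    where
    o≡o′ : o ≡ o′
    o≡o′ = ∷-injectiveˡ (trans (sym c→o) (trans (cong toRoot same) c′→o′))

  inC : Fin n × Fin n → Bool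
  inC (u , v) = mem C u v

  cEdges outEdges : List (Fin n × Fin n)
  cEdges   = filterᵇ inC edgeList
  outEdges = filterᵇ (not ∘ inC) edgeList

  ∈-cEdges : ∀ {e} → e ∈ cEdges → toℕ (proj₁ e) < toℕ (proj₂ e) × CAdj (proj₁ e) (proj₂ e)
  ∈-cEdges h with ∈-filter⁻ (T? ∘ inC) {xs = edgeList} h
  ... | e∈E , inside = proj₁ (∈-edgeList e∈E) , Equivalence.to T-≡ inside

  ∈-outEdges : ∀ {e} → e ∈ outEdges →
               toℕ (proj₁ e) < toℕ (proj₂ e) × Adj (proj₁ e) (proj₂ e) × ¬ CAdj (proj₁ e) (proj₂ e)
  ∈-outEdges h with ∈-filter⁻ (T? ∘ not ∘ inC) {xs = edgeList} h
  ... | e∈E , outside = proj₁ (∈-edgeList e∈E) , proj₂ (∈-edgeList e∈E) ,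
                        λ inside → case trans (sym inside) (Equivalence.to T-not-≡ outside) of λ ()

  cEdges-bound : length cEdges ≤ n
  cEdges-bound = injection-bound (filter⁺ (T? ∘ inC) edgeList-unique) (λ (x , y) → child x y) charge-injective
    where
    charge-injective : ∀ {a b} → a ∈ cEdges → b ∈ cEdges → child (proj₁ a) (proj₂ a) ≡ child (proj₁ b) (proj₂ b) → a ≡ b
    charge-injective a∈ b∈ = child-injective (proj₁ (∈-cEdges a∈)) (proj₂ (∈-cEdges a∈))
                                             (proj₁ (∈-cEdges b∈)) (proj₂ (∈-cEdges b∈))

  outEdges-identified⇒≡ : ∀ {e e′} → e ∈ outEdges → e′ ∈ outEdges → Identified e e′ → e ≡ e′
  outEdges-identified⇒≡ {u , v} {u′ , v′} h h′ identified with ∈-outEdges h | ∈-outEdges h′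
  ... | u<v , uv , out | u′<v′ , u′v′ , out′ =
    increasing-pair-unique u<v u′<v′ (same-ends identified) (inj₁ (refl , refl))
    where
    same-ends : Identified (u , v) (u′ , v′) → SamePair u v u′ v′
    same-ends (inj₁ (s₁ , s₂)) = inj₁ (outside-edges-parallel uv out u′v′ out′ s₁ s₂)
    same-ends (inj₂ (s₁ , s₂)) = inj₂ (outside-edges-parallel uv out (adj-sym u′v′) (out′ ∘ cadj-sym) s₁ s₂)

  outEdges-survive : AtLeastEdgesQuot C (length outEdges)
  outEdges-survive = lookup outEdges , survives , distinct
    where
    survives : ∀ i → Survives (lookup outEdges i)
    survives i with ∈-outEdges (∈-lookup {xs = outEdges} i)
    ... | _ , uv , out = uv , outside-edge-separates uv out
    distinct : ∀ i j → i ≢ j → ¬ Identified (lookup outEdges i) (lookup outEdges j)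
    distinct i j i≢j identified =
      i≢j (Sequences.lookup-injective (filter⁺ (T? ∘ not ∘ inC) edgeList-unique) i j
            (outEdges-identified⇒≡ (∈-lookup i) (∈-lookup j) identified))

  contraction-keeps-edges : ∃ λ m → AtLeastEdgesQuot C m × numEdges G ≤ n + m
  contraction-keeps-edges = length outEdges , outEdges-survive , (begin
    numEdges G                            ≡⟨ numEdges≡ ⟩
    length edgeList                       ≡⟨ sym (length-split inC edgeList) ⟩
    length cEdges + length outEdges       ≤⟨ +-monoˡ-≤ (length outEdges) cEdges-bound ⟩
    n + length outEdges                   ∎)
    where open ≤-Reasoning

^-distribʳ-* : ∀ a b k → (a * b) ^ k ≡ a ^ k * b ^ k
^-distribʳ-* a b zero    = refl
^-distribʳ-* a b (suc k) = trans (cong (a * b *_) (^-distribʳ-* a b k))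
  (solve 4 (λ a b x y → (a :* b) :* (x :* y) := (a :* x) :* (b :* y)) refl a b (a ^ k) (b ^ k))
  where open +-*-Solver

regroup-2 : ∀ q m → q * (2 * m) ≡ 2 * q * m
regroup-2 q m = trans (sym (*-assoc q 2 m)) (cong (_* m) (*-comm q 2))

dense⇒2n≤E : ∀ {n q k E} .{{_ : NonZero q}} .{{_ : NonZero k}} →
             (2 * q) ^ k ≤ n → n ^ (k + 1) ≤ (q * E) ^ k → 2 * n ≤ E
dense⇒2n≤E {n} {q} {k} {E} large dense with 2 * n ≤? E
... | yes 2n≤E = 2n≤E
... | no  2n≰E = contradiction dense (<⇒≱ (begin-strict
  (q * E) ^ k          <⟨ ^-monoˡ-< k (*-monoʳ-< q (≰⇒> 2n≰E)) ⟩
  (q * (2 * n)) ^ k    ≡⟨ cong (_^ k) (regroup-2 q n) ⟩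
  (2 * q * n) ^ k      ≡⟨ ^-distribʳ-* (2 * q) n k ⟩
  (2 * q) ^ k * n ^ k  ≤⟨ *-monoˡ-≤ (n ^ k) large ⟩
  n * n ^ k            ≡⟨ cong (n ^_) (+-comm 1 k) ⟩
  n ^ (k + 1)          ∎))
  where open ≤-Reasoning

half-survive : ∀ {n m E} → E ≤ n + m → 2 * n ≤ E → E ≤ 2 * m
half-survive {n} {m} E≤n+m 2n≤E = ≤-trans E≤n+m (+-≤-double n≤m ≤-refl)
  where
  n≤m : n ≤ m
  n≤m = subst (_≤ m) (+-identityʳ n) (+-cancelˡ-≤ n (n + 0) m (≤-trans 2n≤E E≤n+m))

contracted-dense : ∀ {n q k α β} .{{_ : NonZero q}} .{{_ : NonZero k}} (G : Graph n) →
                   (∀ L → L < 2 * k + 1 → ¬ HasCycleOfLength G L) →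
                   (2 * q) ^ k ≤ n → n ^ (k + 1) ≤ (q * numEdges G) ^ k →
                   ∀ (C : EdgeSubset G) → α * β < k → IsContraction C α β →
                   ∃ λ m → AtLeastEdgesQuot C m × n ^ (k + 1) ≤ (2 * q * m) ^ k
contracted-dense {n} {q} {k} {α} {β} G no-short-cycle large dense C αβ<k contraction
  with ContractionForest.contraction-keeps-edges G k no-short-cycle C {α} {β} αβ<k contraction
... | m , survivors , E≤n+m = m , survivors , (begin
  n ^ (k + 1)              ≤⟨ dense ⟩
  (q * numEdges G) ^ k     ≤⟨ ^-monoˡ-≤ k (*-monoʳ-≤ q (half-survive {n} E≤n+m (dense⇒2n≤E {n} {q} {k} large dense))) ⟩
  (q * (2 * m)) ^ k        ≡⟨ cong (_^ k) (regroup-2 q m) ⟩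
  (2 * q * m) ^ k          ∎)
  where open ≤-Reasoning

theorem29 : GirthConjecture →
    ∀ (k : ℕ) → 2 ≤ k →
      Σ ℕ λ q → 1 ≤ q × ∀ (N : ℕ) → Σ ℕ λ n → N ≤ n × Σ (Graph n) λ G →
        ∀ (C : EdgeSubset G) → IsContraction C (k ∸ 1) 1 →
          Σ ℕ λ m → AtLeastEdgesQuot C m × n ^ (k + 1) ≤ (q * m) ^ k
theorem29 girth-conjecture k@(suc (suc k′)) (s≤s (s≤s z≤n)) with girth-conjecture k (s≤s z≤n)
... | q , 1≤q , family = 2 * q , ≤-trans 1≤q (m≤m+n q (q + 0)) , λ N →
  let (n , N+[2q]^k≤n , G , (_ , no-short-cycle) , dense) = family (N + (2 * q) ^ k) in
  n , ≤-trans (m≤m+n N _) N+[2q]^k≤n , G , λ C contraction →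
  contracted-dense {α = k ∸ 1} {β = 1} {{>-nonZero 1≤q}} G no-short-cycle (≤-trans (m≤n+m _ N) N+[2q]^k≤n) dense
    C [k∸1]·1<k contraction
  where
  [k∸1]·1<k : (k ∸ 1) * 1 < k
  [k∸1]·1<k = subst (_< k) (sym (*-identityʳ (suc k′))) ≤-refl
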